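{- Let $Q$ be a query over the nodes of a $\lambda$-graph $G$. Then $Q^{\Downarrow}$ is a bisimulation if and only if there exists a bisimulation containing $Q$.
   Context: A $\lambda$-graph is a finite directed graph with application nodes $\mathrm{App}(n_1,n_2)$ (left child $n_1$; right child $n_2$), abstraction nodes $\mathrm{Abs}(n)$ (child $n$), free variable nodes (no children) and bound variable nodes $\mathrm{Var}(l)$ with a binding edge to an abstraction node $l$. Paths follow only child edges. A root is a node with no path of nonempty length ending at it. The graph is acyclic (ignoring binding edges) and every path from a root to a bound variable node passes through its binder. Nodes are homogeneous if of the same kind (application, abstraction, free variable, bound variable). A bisimulation is a relation $R$ relating only homogeneous nodes and closed under: $\mathrm{App}(n_1,n_2)\,R\,\mathrm{App}(m_1,m_2)\Rightarrow n_1Rm_1$ and $n_2Rm_2$; $\mathrm{Abs}(n)\,R\,\mathrm{Abs}(m)\Rightarrow nRm$; $\mathrm{Var}(n)\,R\,\mathrm{Var}(m)\Rightarrow nRm$. A query is a binary relation on the roots of $G$. The propagation $Q^{\Downarrow}$ is the smallest relation containing $Q$ closed under the $\mathrm{App}$ and $\mathrm{Abs}$ rules. -}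

module Defs where

open import Data.Nat using (ℕ)
open import Data.Fin using (Fin)
open import Data.Product using (Σ; ∃; _×_; _,_)
open import Data.Empty using (⊥)
open import Data.Unit using (⊤)
open import Relation.Nullary using (¬_)
open import Relation.Binary.PropositionalEquality using (_≡_)
open import Level using (0ℓ)

data Node (n : ℕ) : Set where
  app  : Fin n → Fin n → Node n
  abs  : Fin n → Node n
  fvar : Node n
  bvar : Fin n → Node n           -- bound variable with binding edge to its binder

Graph : ℕ → Set
Graph n = Fin n → Node n

-- child edges (binding edges are NOT child edges)
data Child {n : ℕ} (G : Graph n) : Fin n → Fin n → Set where
  appˡ : ∀ {a b c} → G a ≡ app b c → Child G a b
  appʳ : ∀ {a b c} → G a ≡ app b c → Child G a c
  absᶜ : ∀ {a b}   → G a ≡ abs b   → Child G a b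

data Path {n : ℕ} (G : Graph n) : Fin n → Fin n → Set where
  [] : ∀ {a} → Path G a a
  _∷_ : ∀ {a b c} → Child G a b → Path G b c → Path G a c

NonEmptyPath : ∀ {n} → Graph n → Fin n → Fin n → Set
NonEmptyPath G a c = ∃ λ b → Child G a b × Path G b c

data Visits {n : ℕ} {G : Graph n} (x : Fin n) : ∀ {a c} → Path G a c → Set where
  here-[] : Visits x {x} {x} []
  here    : ∀ {b c} (e : Child G x b) (p : Path G b c) → Visits x (e ∷ p)
  there   : ∀ {a b c} (e : Child G a b) {p : Path G b c} → Visits x p → Visits x (e ∷ p)

IsRoot : ∀ {n} → Graph n → Fin n → Set
IsRoot G r = ∀ a → ¬ NonEmptyPath G a r

record IsLambdaGraph {n : ℕ} (G : Graph n) : Set where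
  field
    binder-abs : ∀ v l → G v ≡ bvar l → ∃ λ b → G l ≡ abs b
    -- acyclic (ignoring binding edges)
    acyclic    : ∀ a → ¬ NonEmptyPath G a a
    scoped     : ∀ r v l → IsRoot G r → G v ≡ bvar l → (p : Path G r v) → Visits l p

Rel : ℕ → Set₁
Rel n = Fin n → Fin n → Set

_⊆_ : ∀ {n} → Rel n → Rel n → Set
Q ⊆ R = ∀ {a b} → Q a b → R a b

Homogeneous : ∀ {n} → Node n → Node n → Set
Homogeneous (app _ _) (app _ _) = ⊤
Homogeneous (abs _)   (abs _)   = ⊤
Homogeneous fvar      fvar      = ⊤
Homogeneous (bvar _)  (bvar _)  = ⊤
Homogeneous _         _         = ⊥

record IsBisimulation {n : ℕ} (G : Graph n) (R : Rel n) : Set where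
  field
    homogeneous : ∀ {a b} → R a b → Homogeneous (G a) (G b)
    app-closed  : ∀ {a b n₁ n₂ m₁ m₂} → R a b → G a ≡ app n₁ n₂ → G b ≡ app m₁ m₂ →
                  R n₁ m₁ × R n₂ m₂
    abs-closed  : ∀ {a b c d} → R a b → G a ≡ abs c → G b ≡ abs d → R c d
    var-closed  : ∀ {a b c d} → R a b → G a ≡ bvar c → G b ≡ bvar d → R c d

IsQuery : ∀ {n} → Graph n → Rel n → Set
IsQuery G Q = ∀ {a b} → Q a b → IsRoot G a × IsRoot G b

data _⇓ {n : ℕ} {G : Graph n} (Q : Rel n) : Rel n where
  base  : ∀ {a b} → Q a b → (Q ⇓) a b
  appL  : ∀ {a b n₁ n₂ m₁ m₂} → _⇓ {G = G} Q a b → G a ≡ app n₁ n₂ → G b ≡ app m₁ m₂ → (Q ⇓) n₁ m₁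
  appR  : ∀ {a b n₁ n₂ m₁ m₂} → _⇓ {G = G} Q a b → G a ≡ app n₁ n₂ → G b ≡ app m₁ m₂ → (Q ⇓) n₂ m₂
  absC  : ∀ {a b c d} → _⇓ {G = G} Q a b → G a ≡ abs c → G b ≡ abs d → (Q ⇓) c d

Propagation : ∀ {n} → Graph n → Rel n → Rel n
Propagation G Q = _⇓ {G = G} Q

-- (⇒) is immediate.  For (⇐), let R ⊇ Q be a bisimulation.  Q⇓ is the least
-- relation containing Q closed under the App/Abs rules, so Q⇓ ⊆ R; this gives
-- homogeneity, and App/Abs closure hold by construction.  The only real work
-- is closure under binding edges.  Label child edges by direction (left,
-- right, body): then Q⇓ a b holds iff a and b are reached by two walks with
-- the same word from a pair of roots related by Q.  If a = Var(c) and
-- b = Var(d), scoping says both walks pass through the binders c and d.  When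
-- they reach them at the same position, Q⇓ c d follows.  Otherwise one binder,
-- say d, lies strictly below the node m met in lockstep with c; but R c m and
-- R c d, and bisimilar nodes read the same words, so every word read from m
-- is read from its proper descendant d.  Iterating produces arbitrarily long
-- walks, which acyclicity of a finite graph forbids (pigeonhole).
module Submission where

open import Defs
open import Data.Nat using (ℕ; zero; suc; s≤s; z≤n) renaming (_≤_ to _≤ℕ_)
open import Data.Nat.Properties using (≤-trans)
open import Data.Fin using (Fin; zero; suc; _<_)
open import Data.Fin.Properties using (pigeonhole)
open import Data.List using (List; []; _∷_; _++_; [_]; length)
open import Data.List.Properties using (length-++-≤ʳ; ∷-injective)
open import Data.Product using (Σ; _×_; _,_; ∃; proj₁; proj₂)
open import Data.Empty using (⊥; ⊥-elim)
open import Relation.Nullary using (¬_)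
open import Data.Unit using (tt)
open import Function.Base using (flip)
open import Relation.Binary.PropositionalEquality using (_≡_; refl; sym; trans; subst)
open import Function.Bundles using (_⇔_; mk⇔)

data Aligned {A : Set} : List A → List A → Set where
  equal  : ∀ {u} → Aligned u u
  before : ∀ {u} x t → Aligned u (u ++ x ∷ t)
  after  : ∀ {u} x t → Aligned (u ++ x ∷ t) u

prefixes-aligned : ∀ {A : Set} (u₁ v₁ u₂ v₂ : List A) → u₁ ++ v₁ ≡ u₂ ++ v₂ → Aligned u₁ u₂
prefixes-aligned []       _  []       _  _  = equal
prefixes-aligned []       _  (x ∷ t)  _  _  = before x t
prefixes-aligned (x ∷ t)  _  []       _  _  = after x t
prefixes-aligned (x ∷ u₁) v₁ (y ∷ u₂) v₂ eq with ∷-injective eq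
... | refl , eq′ with prefixes-aligned u₁ v₁ u₂ v₂ eq′
...   | equal      = equal
...   | before z t = before z t
...   | after z t  = after z t

homogeneous-sym : ∀ {n} (u t : Node n) → Homogeneous u t → Homogeneous t u
homogeneous-sym (app _ _) (app _ _) h = tt
homogeneous-sym (abs _)   (abs _)   h = tt
homogeneous-sym fvar      fvar      h = tt
homogeneous-sym (bvar _)  (bvar _)  h = tt

app-partner : ∀ {n} {u t : Node n} {b c} → Homogeneous u t → u ≡ app b c → ∃ λ b′ → ∃ λ c′ → t ≡ app b′ c′
app-partner {t = app b′ c′} _ refl = b′ , c′ , refl

abs-partner : ∀ {n} {u t : Node n} {b} → Homogeneous u t → u ≡ abs b → ∃ λ b′ → t ≡ abs b′
abs-partner {t = abs b′} _ refl = b′ , refl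

data Dir : Set where
  left right body : Dir

module _ {n : ℕ} (G : Graph n) where

  data Step : Fin n → Dir → Fin n → Set where
    step-left  : ∀ {a b c} → G a ≡ app b c → Step a left b
    step-right : ∀ {a b c} → G a ≡ app b c → Step a right c
    step-body  : ∀ {a b}   → G a ≡ abs b   → Step a body b

  data Walk : Fin n → List Dir → Fin n → Set where
    []  : ∀ {a} → Walk a [] a
    _∷_ : ∀ {a d b ds c} → Step a d b → Walk b ds c → Walk a (d ∷ ds) c

  Reads : Fin n → List Dir → Set
  Reads x ws = ∃ λ z → Walk x ws z

  step-child : ∀ {a d b} → Step a d b → Child G a b
  step-child (step-left e)  = appˡ e
  step-child (step-right e) = appʳ e
  step-child (step-body e)  = absᶜ e

  walk-path : ∀ {x ws z} → Walk x ws z → Path G x z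
  walk-path []      = []
  walk-path (s ∷ w) = step-child s ∷ walk-path w

  walk-++ : ∀ {x u y v z} → Walk x u y → Walk y v z → Walk x (u ++ v) z
  walk-++ []      w′ = w′
  walk-++ (s ∷ w) w′ = s ∷ walk-++ w w′

  walk-split : ∀ {x v z} u → Walk x (u ++ v) z → ∃ λ m → Walk x u m × Walk m v z
  walk-split []      w       = _ , [] , w
  walk-split (_ ∷ u) (s ∷ w) with walk-split u w
  ... | m , w₁ , w₂ = m , s ∷ w₁ , w₂

  visited-prefix : ∀ {x ws z c} (w : Walk x ws z) → Visits c (walk-path w) →
                   ∃ λ u → ∃ λ v → (ws ≡ u ++ v) × Walk x u c
  visited-prefix []      here-[]     = [] , [] , refl , []
  visited-prefix (s ∷ w) (here _ _)  = [] , _ , refl , []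
  visited-prefix (s ∷ w) (there _ p) with visited-prefix w p
  ... | u , v , refl , w′ = _ ∷ u , v , refl , s ∷ w′

  node-at : ∀ {x ws z} → Walk x ws z → Fin (suc (length ws)) → Fin n
  node-at {x} _       zero    = x
  node-at     (_ ∷ w) (suc i) = node-at w i

  path-to-node : ∀ {x ws z} (w : Walk x ws z) j → Path G x (node-at w j)
  path-to-node _       zero    = []
  path-to-node (s ∷ w) (suc j) = step-child s ∷ path-to-node w j

  path-between : ∀ {x ws z} (w : Walk x ws z) i j → i < j →
                 NonEmptyPath G (node-at w i) (node-at w j)
  path-between (s ∷ w) zero    (suc j) _         = _ , step-child s , path-to-node w j
  path-between (s ∷ w) (suc i) (suc j) (s≤s i<j) = path-between w i j i<j

  Acyclic : Set
  Acyclic = ∀ a → ¬ NonEmptyPath G a a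

  module _ (acyclic : Acyclic) where

    -- No walk has n or more steps: its length + 1 nodes would repeat
    -- (pigeonhole), closing a cycle.
    no-long-walk : ∀ {x ws z} → Walk x ws z → n ≤ℕ length ws → ⊥
    no-long-walk w n≤len with pigeonhole (s≤s n≤len) (node-at w)
    ... | i , j , i<j , same =
      acyclic _ (subst (NonEmptyPath G (node-at w i)) (sym same) (path-between w i j i<j))

    -- A proper descendant y of x cannot read every word that x reads:
    -- otherwise prefixing with the word leading from x to y would give x
    -- readable words of every length.
    no-pumping : ∀ {x y d u} → Walk x (d ∷ u) y → (∀ {ws} → Reads x ws → Reads y ws) → ⊥
    no-pumping {x} {d = d} {u = u} x⇝y x⊆y =
      let _ , n≤len , _ , w = long-reads n in no-long-walk w n≤len
      where
        long-reads : ∀ k → ∃ λ ws → k ≤ℕ length ws × Reads x ws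
        long-reads zero = [] , z≤n , x , []
        long-reads (suc k) with long-reads k
        ... | ws , k≤len , r with x⊆y r
        ...   | _ , y⇝ = d ∷ u ++ ws , s≤s (≤-trans k≤len (length-++-≤ʳ ws {u})) , _ , walk-++ x⇝y y⇝

  module _ {R : Rel n} (bisim : IsBisimulation G R) where
    open IsBisimulation bisim

    flip-bisimulation : IsBisimulation G (flip R)
    flip-bisimulation = record
      { homogeneous = λ {a} {b} r → homogeneous-sym (G b) (G a) (homogeneous r)
      ; app-closed  = λ r e₁ e₂ → app-closed r e₂ e₁
      ; abs-closed  = λ r e₁ e₂ → abs-closed r e₂ e₁
      ; var-closed  = λ r e₁ e₂ → var-closed r e₂ e₁
      }

    match-step : ∀ {x y d z} → R x y → Step x d z → ∃ λ z′ → Step y d z′ × R z z′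
    match-step r (step-left e) with app-partner (homogeneous r) e
    ... | _ , _ , e′ = _ , step-left e′ , proj₁ (app-closed r e e′)
    match-step r (step-right e) with app-partner (homogeneous r) e
    ... | _ , _ , e′ = _ , step-right e′ , proj₂ (app-closed r e e′)
    match-step r (step-body e) with abs-partner (homogeneous r) e
    ... | _ , e′ = _ , step-body e′ , abs-closed r e e′

    match-reads : ∀ {x y ws} → R x y → Reads x ws → Reads y ws
    match-reads r (_ , [])    = _ , []
    match-reads r (_ , s ∷ w) with match-step r s
    ... | _ , s′ , r′ with match-reads r′ (_ , w)
    ...   | _ , w′ = _ , s′ ∷ w′

  -- In an acyclic graph, if a bisimulation relates x to both y and z, then z
  -- is not a proper descendant of y (y reads x's words, which z reads).
  no-related-descendant : Acyclic → ∀ {R : Rel n} → IsBisimulation G R →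
                          ∀ {x y z d u} → R x y → R x z → Walk y (d ∷ u) z → ⊥
  no-related-descendant acyclic bisim rxy rxz y⇝z =
    no-pumping acyclic y⇝z λ r → match-reads bisim rxz (match-reads (flip-bisimulation bisim) rxy r)

  module _ {Q : Rel n} where

    propagation-least : ∀ {R : Rel n} → IsBisimulation G R → Q ⊆ R → Propagation G Q ⊆ R
    propagation-least bisim Q⊆R (base q)       = Q⊆R q
    propagation-least bisim Q⊆R (appL p e₁ e₂) =
      proj₁ (IsBisimulation.app-closed bisim (propagation-least bisim Q⊆R p) e₁ e₂)
    propagation-least bisim Q⊆R (appR p e₁ e₂) =
      proj₂ (IsBisimulation.app-closed bisim (propagation-least bisim Q⊆R p) e₁ e₂)
    propagation-least bisim Q⊆R (absC p e₁ e₂) =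
      IsBisimulation.abs-closed bisim (propagation-least bisim Q⊆R p) e₁ e₂

    Lockstep : Rel n
    Lockstep a b = ∃ λ r → ∃ λ r′ → ∃ λ ws → Q r r′ × Walk r ws a × Walk r′ ws b

    lockstep-step : ∀ {a b a′ b′ d} → Lockstep a b → Step a d a′ → Step b d b′ → Lockstep a′ b′
    lockstep-step (r , r′ , ws , q , wa , wb) sa sb =
      r , r′ , ws ++ [ _ ] , q , walk-++ wa (sa ∷ []) , walk-++ wb (sb ∷ [])

    propagation-lockstep : Propagation G Q ⊆ Lockstep
    propagation-lockstep (base q)       = _ , _ , [] , q , [] , []
    propagation-lockstep (appL p e₁ e₂) = lockstep-step (propagation-lockstep p) (step-left e₁) (step-left e₂)
    propagation-lockstep (appR p e₁ e₂) = lockstep-step (propagation-lockstep p) (step-right e₁) (step-right e₂)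
    propagation-lockstep (absC p e₁ e₂) = lockstep-step (propagation-lockstep p) (step-body e₁) (step-body e₂)

    propagation-along : ∀ {x y a b ws} → Propagation G Q x y → Walk x ws a → Walk y ws b → Propagation G Q a b
    propagation-along p []                   []                   = p
    propagation-along p (step-left e₁ ∷ wa)  (step-left e₂ ∷ wb)  = propagation-along (appL p e₁ e₂) wa wb
    propagation-along p (step-right e₁ ∷ wa) (step-right e₂ ∷ wb) = propagation-along (appR p e₁ e₂) wa wb
    propagation-along p (step-body e₁ ∷ wa)  (step-body e₂ ∷ wb)  = propagation-along (absC p e₁ e₂) wa wb

module _ {n : ℕ} {G : Graph n} (λ-graph : IsLambdaGraph G)
         {Q : Rel n} (query : IsQuery G Q)
         {R : Rel n} (bisim : IsBisimulation G R) (Q⊆R : Q ⊆ R) where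

  open IsLambdaGraph λ-graph

  -- Binders c, d with R c d, reached from a pair in Q by walks whose words
  -- are aligned prefixes of each other, are related by Q⇓: if the prefixes
  -- differ, one binder is a proper descendant of the lockstep partner of the
  -- other, which bisimilarity forbids.
  binders-propagated : ∀ {r r′ u₁ u₂ c d} → Q r r′ → Walk G r u₁ c → Walk G r′ u₂ d →
                       Aligned u₁ u₂ → R c d → Propagation G Q c d
  binders-propagated q r⇝c r′⇝d equal rcd = propagation-along G (base q) r⇝c r′⇝d
  binders-propagated {u₁ = u₁} {c = c} q r⇝c r′⇝d (before _ _) rcd
    with walk-split G u₁ r′⇝d
  ... | m , r′⇝m , m⇝d = ⊥-elim (no-related-descendant G acyclic bisim rcm rcd m⇝d)
    where
      rcm : R c m
      rcm = propagation-least G bisim Q⊆R (propagation-along G (base q) r⇝c r′⇝m)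
  binders-propagated {u₂ = u₂} {d = d} q r⇝c r′⇝d (after _ _) rcd
    with walk-split G u₂ r⇝c
  ... | m , r⇝m , m⇝c = ⊥-elim (no-related-descendant G acyclic (flip-bisimulation G bisim) rmd rcd m⇝c)
    where
      rmd : R m d
      rmd = propagation-least G bisim Q⊆R (propagation-along G (base q) r⇝m r′⇝d)

  -- Two bound variables related by Q⇓ have binders related by Q⇓: scoping puts
  -- the binders on the lockstep walks reaching the variables.
  propagation-var-closed : ∀ {a b c d} → Propagation G Q a b → G a ≡ bvar c → G b ≡ bvar d →
                           Propagation G Q c d
  propagation-var-closed p ea eb with propagation-lockstep G p
  ... | r , r′ , ws , q , r⇝a , r′⇝b
    with visited-prefix G r⇝a (scoped r _ _ (proj₁ (query q)) ea (walk-path G r⇝a))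
       | visited-prefix G r′⇝b (scoped r′ _ _ (proj₂ (query q)) eb (walk-path G r′⇝b))
  ...   | u₁ , v₁ , ws≡u₁v₁ , r⇝c | u₂ , v₂ , ws≡u₂v₂ , r′⇝d =
    binders-propagated q r⇝c r′⇝d (prefixes-aligned u₁ v₁ u₂ v₂ (trans (sym ws≡u₁v₁) ws≡u₂v₂))
      (IsBisimulation.var-closed bisim (propagation-least G bisim Q⊆R p) ea eb)

  propagation-bisimulation : IsBisimulation G (Propagation G Q)
  propagation-bisimulation = record
    { homogeneous = λ p → IsBisimulation.homogeneous bisim (propagation-least G bisim Q⊆R p)
    ; app-closed  = λ p e₁ e₂ → appL p e₁ e₂ , appR p e₁ e₂
    ; abs-closed  = absC
    ; var-closed  = propagation-var-closed
    }

mainTheorem10 : (n : ℕ) (G : Graph n) → IsLambdaGraph G →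
                (Q : Rel n) → IsQuery G Q →
                IsBisimulation G (Propagation G Q) ⇔ Σ (Rel n) (λ R → IsBisimulation G R × (Q ⊆ R))
mainTheorem10 n G λ-graph Q query =
  mk⇔ (λ bisim → Propagation G Q , bisim , λ {_} {_} q → base q)
      (λ (R , bisim , Q⊆R) → propagation-bisimulation λ-graph query bisim Q⊆R)
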